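{- Let $\lambda\in\mathcal P^+$, $k\ge1$, and let $\boldsymbol\lambda^{\max}\in\mathcal P^+(\lambda,k)$ be as defined in the context. Then for every $\boldsymbol\mu\in\mathcal P^+(\lambda,k)$ we have $\boldsymbol\mu\trianglelefteq\boldsymbol\lambda^{\max}$. Moreover, if $\boldsymbol\lambda^{\max}\sim\boldsymbol\mu$, then $\boldsymbol\mu$ and $\boldsymbol\lambda^{\max}$ lie in the same $S_k$-orbit (i.e. $\boldsymbol\mu$ is obtained from $\boldsymbol\lambda^{\max}$ by permuting components).
   Context: $\mathcal P^+=\mathbb Z_{\ge0}^n$ with standard basis $\omega_1,\dots,\omega_n$, coordinate functionals $\omega_i^*$, and $\epsilon_i=\omega_i-\omega_{i-1}$ ($\omega_0=0$). $\mathcal P^+(\lambda,k)$ is the set of $k$-tuples of elements of $\mathcal P^+$ summing to $\lambda$. For $1\le i\le j\le n$, $1\le\ell\le k$, $r_{(i,j),\ell}(\boldsymbol\lambda)=\min\{\sum_{t=i}^j\omega_t^*(\lambda_{n_1}+\dots+\lambda_{n_\ell}):1\le n_1<\dots<n_\ell\le k\}$; $\boldsymbol\lambda\trianglelefteq\boldsymbol\mu$ iff $r_{(i,j),\ell}(\boldsymbol\lambda)\le r_{(i,j),\ell}(\boldsymbol\mu)$ for all $i\le j,\ell$, and $\boldsymbol\lambda\sim\boldsymbol\mu$ iff equality holds for all $i\le j,\ell$. Definition of $\boldsymbol\lambda^{\max}$: for $\lambda=(a_1,\dots,a_n)$ write $\sum_{t=i}^n a_t=p_ik+r_i$ with $p_i\ge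 0$, $0\le r_i<k$; let $m^{i,j}=p_i+1$ if $j\le r_i$ and $m^{i,j}=p_i$ otherwise; $\lambda_j=\sum_{i=1}^n m^{i,j}\epsilon_i$ for $1\le j\le k$, and $\boldsymbol\lambda^{\max}=(\lambda_1,\dots,\lambda_k)$. $S_k$ acts on $\mathcal P^+(\lambda,k)$ by permuting components. -}

module Defs where

open import Data.Nat using (ℕ; zero; suc; _+_; _∸_; _≤_; _⊓_; _≤ᵇ_; _<ᵇ_; NonZero)
open import Data.Nat.DivMod using (_/_; _%_)
open import Data.Fin using (Fin; toℕ) renaming (zero to fzero; suc to fsuc)
open import Data.List using (List; []; _∷_; map; _++_; foldr; allFin)
open import Data.Nat.ListAction using (sum)
open import Data.Bool using (if_then_else_)
open import Function using (_∘_)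

-- Weights in P^+ = ℤ_{≥0}^n are functions Fin n → ℕ; coordinate t (0-based)
-- is ω_{t+1}^*.  A k-tuple of weights is a function Fin k → Fin n → ℕ.
Weight : ℕ → Set
Weight n = Fin n → ℕ

Tuple : ℕ → ℕ → Set
Tuple n k = Fin k → Weight n

sumF : ∀ {n} → (Fin n → ℕ) → ℕ
sumF {zero}  f = 0
sumF {suc n} f = f fzero + sumF (f ∘ fsuc)

InP : ∀ {n k} → Weight n → Tuple n k → Set
InP {n} {k} lam μ = ∀ (t : Fin n) → sumF (λ m → μ m t) ≡ lam t
  where open import Relation.Binary.PropositionalEquality using (_≡_)

-- all sublists of length ℓ, preserving order (strictly increasing index tuples)
choose : ∀ {A : Set} → ℕ → List A → List (List A)
choose zero    xs       = [] ∷ []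
choose (suc l) []       = []
choose (suc l) (x ∷ xs) = map (x ∷_) (choose l xs) ++ choose (suc l) xs

-- minimum of a list (only applied to nonempty lists below)
minList : List ℕ → ℕ
minList []       = 0
minList (x ∷ xs) = foldr _⊓_ x xs

sumComps : ∀ {n k} → Tuple n k → List (Fin k) → Weight n
sumComps μ S t = sum (map (λ m → μ m t) S)

segment : ∀ {n} → Fin n → Fin n → Weight n → ℕ
segment i j v = sumF (λ t → if toℕ i ≤ᵇ toℕ t then (if toℕ t ≤ᵇ toℕ j then v t else 0) else 0)

r : ∀ {n k} → Fin n → Fin n → ℕ → Tuple n k → ℕ
r {n} {k} i j ℓ μ = minList (map (λ S → segment i j (sumComps μ S)) (choose ℓ (allFin k)))

_⊴_ : ∀ {n k} → Tuple n k → Tuple n k → Set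
_⊴_ {n} {k} μ ν = ∀ (i j : Fin n) → toℕ i ≤ toℕ j → ∀ (ℓ : ℕ) → 1 ≤ ℓ → ℓ ≤ k → r i j ℓ μ ≤ r i j ℓ ν

_∼_ : ∀ {n k} → Tuple n k → Tuple n k → Set
_∼_ {n} {k} μ ν = ∀ (i j : Fin n) → toℕ i ≤ toℕ j → ∀ (ℓ : ℕ) → 1 ≤ ℓ → ℓ ≤ k → r i j ℓ μ ≡ r i j ℓ ν
  where open import Relation.Binary.PropositionalEquality using (_≡_)

suffix : ∀ {n} → Weight n → ℕ → ℕ
suffix a i = sumF (λ u → if i ≤ᵇ toℕ u then a u else 0)

-- m^{i,j} (0-based i and j): p_i + [j ≤ r_i] in 1-based terms
mCoef : (k : ℕ) → .{{_ : NonZero k}} → ∀ {n} → Weight n → ℕ → Fin k → ℕ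
mCoef k a i j = (suffix a i / k) + (if toℕ j <ᵇ (suffix a i % k) then 1 else 0)

lmax : (k : ℕ) → .{{_ : NonZero k}} → ∀ {n} → Weight n → Tuple n k
lmax k a j t = mCoef k a (toℕ t) j ∸ mCoef k a (suc (toℕ t)) j

-- For a segment [i, j] write x_c for the [i, j]-segment sum of the c-th component; then r_{(i,j),ℓ} is the least
-- sum of ℓ of the x_c, while Σ_c x_c is fixed by λ. Among vectors with a given total, a balanced one (all entries
-- d or d + 1) has the largest least ℓ-subset sums, and every segment vector of λ^max is balanced: the suffix sums
-- of its components are the staircases q + [c < ρ], where q and ρ are quotient and remainder of a suffix sum of
-- λ by k. Conversely, if μ ∼ λ^max then the 1- and (k - 1)-subsets force every segment vector of μ to be balanced
-- as well. So each suffix sum of a component of μ is q or q + 1, and comparing two positions on the segment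
-- between them shows that the sets of components taking the value q + 1 are nested. One permutation of the
-- components then turns all these sets into initial segments {c < ρ}, which is λ^max.

module Submission where

open import Defs

open import Algebra.Properties.CommutativeSemigroup using (interchange)
open import Data.Bool.Base using (Bool; true; false; if_then_else_; _∧_)
open import Data.Empty using (⊥)
open import Data.Fin.Base using (Fin; toℕ; punchOut; fromℕ<; fromℕ; inject₁) renaming (zero to fzero; suc to fsuc)
open import Data.Fin.Permutation using (Permutation; _⟨$⟩ʳ_; permutation) renaming (id to idₚ)
open import Data.Fin.Properties
  using ( toℕ<n; toℕ-injective; toℕ-fromℕ<; toℕ-fromℕ; toℕ-inject₁; fromℕ<-injective; any?; punchOut-injective
        ; injective⇒≤)
  renaming (_≟_ to _≟ᶠ_)
open import Data.List.Base using (List; []; _∷_; _++_; map; tabulate; allFin; length)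
open import Data.List.Membership.Propositional using (_∈_)
open import Data.List.Membership.Propositional.Properties
  using (∈-map⁺; ∈-map⁻; ∈-++⁺ˡ; ∈-++⁺ʳ; ∈-++⁻; ∈-allFin)
open import Data.List.Properties
  using (map-tabulate; map-++; map-cong; length-tabulate; foldr-preservesᵇ; foldr-preservesᵒ)
import Data.List.Relation.Binary.Permutation.Propositional.Properties as ↭
import Data.List.Relation.Binary.Pointwise.Properties as Pointwise
open import Data.List.Relation.Ternary.Interleaving using ([])
open import Data.List.Relation.Ternary.Interleaving.Properties using (interleave-length)
open import Data.List.Relation.Ternary.Interleaving.Propositional
  using (Interleaving; consˡ; consʳ; left; right; swap; toPermutation)
open import Data.List.Relation.Unary.All as All using (All; []; _∷_)
open import Data.List.Relation.Unary.Any as Any using (here; there)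
open import Data.Nat.Base
open import Data.Nat.DivMod using (_/_; _%_; m≡m%n+[m/n]*n; m%n<n; m%n≤m; 0/n≡0; /-monoˡ-≤)
open import Data.Nat.ListAction using (sum)
open import Data.Nat.ListAction.Properties using (sum-↭; sum-++)
open import Data.Nat.Properties
open import Data.Product.Base using (_×_; _,_; ∃; ∃₂; proj₁; proj₂)
open import Data.Sum.Base as Sum using (_⊎_; inj₁; inj₂; [_,_])
open import Data.Unit.Base using (⊤; tt)
open import Function.Base using (_∘_; id)
open import Function.Bundles using (_⇔_; mk⇔; Equivalence)
open import Function.Definitions using (Injective)
open import Relation.Binary.Definitions using (tri<; tri≈; tri>)
open import Relation.Binary.PropositionalEquality
  using (_≡_; _≢_; refl; sym; trans; cong; cong₂; subst; module ≡-Reasoning)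
open import Relation.Nullary using (Dec; yes; no; does; ¬_; contradiction)
open import Relation.Nullary.Decidable using (_⊎-dec_; _×-dec_; decidable-stable)
open import Relation.Nullary.Reflects using (ofʸ; ofⁿ)

χ : ∀ {P : Set} → Dec P → ℕ
χ d = if does d then 1 else 0

χ≤1 : ∀ {P : Set} (p : Dec P) → χ p ≤ 1
χ≤1 (yes _) = ≤-refl
χ≤1 (no _)  = z≤n

χ-mono : ∀ {P Q : Set} (p : Dec P) (q : Dec Q) → (P → Q) → χ p ≤ χ q
χ-mono (yes p) (yes q) _   = ≤-refl
χ-mono (yes p) (no ¬q) P⇒Q = contradiction (P⇒Q p) ¬q
χ-mono (no _)  _       _   = z≤n

χ-cong : ∀ {P Q : Set} (p : Dec P) (q : Dec Q) → P ⇔ Q → χ p ≡ χ q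
χ-cong p q P⇔Q = ≤-antisym (χ-mono p q (Equivalence.to P⇔Q)) (χ-mono q p (Equivalence.from P⇔Q))

χ-mono-< : ∀ {P Q : Set} (p : Dec P) (q : Dec Q) → ¬ P → Q → χ p < χ q
χ-mono-< (yes p) _       ¬p _ = contradiction p ¬p
χ-mono-< (no _)  (yes _) _  _ = ≤-refl
χ-mono-< (no _)  (no ¬q) _  q = contradiction q ¬q

sumF-cong : ∀ {n} {f g : Fin n → ℕ} → (∀ t → f t ≡ g t) → sumF f ≡ sumF g
sumF-cong {zero}  f≗g = refl
sumF-cong {suc n} f≗g = cong₂ _+_ (f≗g fzero) (sumF-cong (f≗g ∘ fsuc))

sumF-+ : ∀ {n} (f g : Fin n → ℕ) → sumF (λ t → f t + g t) ≡ sumF f + sumF g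
sumF-+ {zero}  f g = refl
sumF-+ {suc n} f g = trans (cong (f fzero + g fzero +_) (sumF-+ (f ∘ fsuc) (g ∘ fsuc)))
                           (interchange +-commutativeSemigroup (f fzero) (g fzero) (sumF (f ∘ fsuc)) (sumF (g ∘ fsuc)))

sumF-const : ∀ n c → sumF {n} (λ _ → c) ≡ n * c
sumF-const zero    c = refl
sumF-const (suc n) c = cong (c +_) (sumF-const n c)

sumF-mono-≤ : ∀ {n} {f g : Fin n → ℕ} → (∀ t → f t ≤ g t) → sumF f ≤ sumF g
sumF-mono-≤ {zero}  f≤g = z≤n
sumF-mono-≤ {suc n} f≤g = +-mono-≤ (f≤g fzero) (sumF-mono-≤ (f≤g ∘ fsuc))

sumF-mono-< : ∀ {n} {f g : Fin n → ℕ} → (∀ t → f t ≤ g t) → ∀ c → f c < g c → sumF f < sumF g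
sumF-mono-< {suc n} f≤g fzero    fc<gc = +-mono-<-≤ fc<gc (sumF-mono-≤ (f≤g ∘ fsuc))
sumF-mono-< {suc n} f≤g (fsuc c) fc<gc = +-mono-≤-< (f≤g fzero) (sumF-mono-< (f≤g ∘ fsuc) c fc<gc)

m+n≡o⇒m≡o∸n : ∀ {m n o} → m + n ≡ o → m ≡ o ∸ n
m+n≡o⇒m≡o∸n {m} {n} refl = sym (m+n∸n≡m m n)

sumF-∸ : ∀ {n} (f g : Fin n → ℕ) → (∀ t → g t ≤ f t) → sumF (λ t → f t ∸ g t) ≡ sumF f ∸ sumF g
sumF-∸ f g g≤f =
  m+n≡o⇒m≡o∸n (trans (sym (sumF-+ (λ t → f t ∸ g t) g)) (sumF-cong (λ t → m∸n+n≡m (g≤f t))))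

sum-tabulate : ∀ {n} (f : Fin n → ℕ) → sum (tabulate f) ≡ sumF f
sum-tabulate {zero}  f = refl
sum-tabulate {suc n} f = cong (f fzero +_) (sum-tabulate (f ∘ fsuc))

sum-map-allFin : ∀ {n} (f : Fin n → ℕ) → sum (map f (allFin n)) ≡ sumF f
sum-map-allFin f = trans (cong sum (map-tabulate id f)) (sum-tabulate f)

maskedSum : ∀ {n} → (Fin n → Bool) → Weight n → ℕ
maskedSum b v = sumF (λ t → if b t then v t else 0)

module _ {n} (b : Fin n → Bool) where

  maskedSum-cong : {v w : Weight n} → (∀ t → v t ≡ w t) → maskedSum b v ≡ maskedSum b w
  maskedSum-cong v≗w = sumF-cong (λ t → cong (λ x → if b t then x else 0) (v≗w t))

  maskedSum-zero : maskedSum b (λ _ → 0) ≡ 0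
  maskedSum-zero = trans (sumF-cong (λ t → if-zero (b t))) (trans (sumF-const n 0) (*-zeroʳ n))
    where
    if-zero : ∀ c → (if c then 0 else 0) ≡ 0
    if-zero true  = refl
    if-zero false = refl

  maskedSum-+ : (v w : Weight n) → maskedSum b (λ t → v t + w t) ≡ maskedSum b v + maskedSum b w
  maskedSum-+ v w =
    trans (sumF-cong (λ t → if-+ (b t))) (sumF-+ (λ t → if b t then v t else 0) (λ t → if b t then w t else 0))
    where
    if-+ : ∀ {x y : ℕ} c → (if c then x + y else 0) ≡ (if c then x else 0) + (if c then y else 0)
    if-+ true  = refl
    if-+ false = refl

  maskedSum-sumF : ∀ {k} (v : Fin k → Weight n) →
                   maskedSum b (λ t → sumF (λ c → v c t)) ≡ sumF (λ c → maskedSum b (v c))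
  maskedSum-sumF {zero}  v = maskedSum-zero
  maskedSum-sumF {suc k} v =
    trans (maskedSum-+ (v fzero) _) (cong (maskedSum b (v fzero) +_) (maskedSum-sumF (v ∘ fsuc)))

  maskedSum-sum : ∀ {A : Set} (v : A → Weight n) (S : List A) →
                  maskedSum b (λ t → sum (map (λ c → v c t) S)) ≡ sum (map (λ c → maskedSum b (v c)) S)
  maskedSum-sum v []      = maskedSum-zero
  maskedSum-sum v (c ∷ S) = trans (maskedSum-+ (v c) _) (cong (maskedSum b (v c) +_) (maskedSum-sum v S))

segment≡maskedSum : ∀ {n} (i j : Fin n) (v : Weight n) →
                    segment i j v ≡ maskedSum (λ t → (toℕ i ≤ᵇ toℕ t) ∧ (toℕ t ≤ᵇ toℕ j)) v
segment≡maskedSum i j v = sumF-cong (λ t → if-if {toℕ t ≤ᵇ toℕ j} {v t} (toℕ i ≤ᵇ toℕ t))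
  where
  if-if : ∀ {c x} b → (if b then (if c then x else 0) else 0) ≡ (if b ∧ c then x else 0)
  if-if true  = refl
  if-if false = refl

module _ {n k} {lam : Weight n} (μ : Tuple n k) (μ∈P : InP lam μ) where

  InP-maskedSum : ∀ b → sumF (λ c → maskedSum b (μ c)) ≡ maskedSum b lam
  InP-maskedSum b = trans (sym (maskedSum-sumF b μ)) (maskedSum-cong b μ∈P)

  InP-segment : ∀ i j → sumF (λ c → segment i j (μ c)) ≡ segment i j lam
  InP-segment i j = begin
    sumF (λ c → segment i j (μ c))  ≡⟨ sumF-cong (λ c → segment≡maskedSum i j (μ c)) ⟩
    sumF (λ c → maskedSum b (μ c))  ≡⟨ InP-maskedSum b ⟩
    maskedSum b lam                 ≡⟨ segment≡maskedSum i j lam ⟨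
    segment i j lam                 ∎
    where
    open ≡-Reasoning
    b = λ t → (toℕ i ≤ᵇ toℕ t) ∧ (toℕ t ≤ᵇ toℕ j)

  InP-suffix : ∀ i → sumF (λ c → suffix (μ c) i) ≡ suffix lam i
  InP-suffix i = InP-maskedSum (λ t → i ≤ᵇ toℕ t)

suffix-suc : ∀ {n} (v : Weight (suc n)) i → suffix v (suc i) ≡ suffix (v ∘ fsuc) i
suffix-suc v i = sumF-cong (λ u → cong (λ b → if b then v (fsuc u) else 0) (<ᵇ-suc i (toℕ u)))
  where
  <ᵇ-suc : ∀ i u → (i <ᵇ suc u) ≡ (i ≤ᵇ u)
  <ᵇ-suc zero    u = refl
  <ᵇ-suc (suc i) u = refl

suffix-step : ∀ {n} (v : Weight n) (t : Fin n) → suffix v (toℕ t) ≡ v t + suffix v (suc (toℕ t))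
suffix-step v fzero    = refl
suffix-step v (fsuc t) = begin
  suffix v (suc (toℕ t))                      ≡⟨ suffix-suc v (toℕ t) ⟩
  suffix (v ∘ fsuc) (toℕ t)                   ≡⟨ suffix-step (v ∘ fsuc) t ⟩
  v (fsuc t) + suffix (v ∘ fsuc) (suc (toℕ t)) ≡⟨ cong (v (fsuc t) +_) (suffix-suc v (suc (toℕ t))) ⟨
  v (fsuc t) + suffix v (suc (suc (toℕ t)))    ∎
  where open ≡-Reasoning

suffix-end : ∀ {n} (v : Weight n) → suffix v n ≡ 0
suffix-end {zero}  v = refl
suffix-end {suc n} v = trans (suffix-suc v n) (suffix-end (v ∘ fsuc))

suffix-antitone : ∀ {n} (v : Weight n) {i i'} → i ≤ i' → suffix v i' ≤ suffix v i
suffix-antitone v {i} {i'} i≤i' = sumF-mono-≤ (λ u → masked-≤ (toℕ u) (v u))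
  where
  masked-≤ : ∀ u x → (if i' ≤ᵇ u then x else 0) ≤ (if i ≤ᵇ u then x else 0)
  masked-≤ u x with i' ≤ᵇ u | ≤ᵇ-reflects-≤ i' u | i ≤ᵇ u | ≤ᵇ-reflects-≤ i u
  ... | false | _         | _     | _       = z≤n
  ... | true  | _         | true  | _       = ≤-refl
  ... | true  | ofʸ i'≤u | false | ofⁿ i≰u = contradiction (≤-trans i≤i' i'≤u) i≰u

segment+suffix : ∀ {n} (i j : Fin n) (v : Weight n) → toℕ i ≤ toℕ j →
                 segment i j v + suffix v (suc (toℕ j)) ≡ suffix v (toℕ i)
segment+suffix i j v i≤j =
  trans (sym (sumF-+ (λ u → if toℕ i ≤ᵇ toℕ u then (if toℕ u ≤ᵇ toℕ j then v u else 0) else 0) _))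
        (sumF-cong (λ u → split (toℕ u) (v u)))
  where
  split : ∀ u x → (if toℕ i ≤ᵇ u then (if u ≤ᵇ toℕ j then x else 0) else 0)
                  + (if suc (toℕ j) ≤ᵇ u then x else 0)
                  ≡ (if toℕ i ≤ᵇ u then x else 0)
  split u x with toℕ i ≤ᵇ u | ≤ᵇ-reflects-≤ (toℕ i) u | u ≤ᵇ toℕ j | ≤ᵇ-reflects-≤ u (toℕ j)
                | suc (toℕ j) ≤ᵇ u | ≤ᵇ-reflects-≤ (suc (toℕ j)) u
  ... | true  | _        | true  | _       | false | _       = +-identityʳ x
  ... | true  | _        | false | _       | true  | _       = refl
  ... | false | _        | _     | _       | false | _       = refl
  ... | _     | _        | true  | ofʸ u≤j | true  | ofʸ j<u = contradiction j<u (≤⇒≯ u≤j)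
  ... | true  | _        | false | ofⁿ u≰j | false | ofⁿ j≮u = contradiction (≰⇒> u≰j) j≮u
  ... | false | ofⁿ i≰u  | _     | _       | true  | ofʸ j<u = contradiction (≤-trans i≤j (<⇒≤ j<u)) i≰u

≡suffix∸suffix : ∀ {n} (v : Weight n) t → v t ≡ suffix v (toℕ t) ∸ suffix v (suc (toℕ t))
≡suffix∸suffix v t = m+n≡o⇒m≡o∸n (sym (suffix-step v t))

segment≡suffix∸suffix : ∀ {n} (i j : Fin n) (v : Weight n) → toℕ i ≤ toℕ j →
                        segment i j v ≡ suffix v (toℕ i) ∸ suffix v (suc (toℕ j))
segment≡suffix∸suffix i j v i≤j = m+n≡o⇒m≡o∸n (segment+suffix i j v i≤j)

suffix-telescope : ∀ {n} (f : ℕ → ℕ) → (∀ i → f (suc i) ≤ f i) → f n ≡ 0 →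
                   ∀ i → i ≤ n → suffix {n} (λ t → f (toℕ t) ∸ f (suc (toℕ t))) i ≡ f i
suffix-telescope {zero}  f f-anti fn≡0 zero    _ = sym fn≡0
suffix-telescope {suc n} f f-anti fn≡0 zero    _ =
  trans (cong (f 0 ∸ f 1 +_) (suffix-telescope {n} (f ∘ suc) (f-anti ∘ suc) fn≡0 0 z≤n)) (m∸n+n≡m (f-anti 0))
suffix-telescope {suc n} f f-anti fn≡0 (suc i) (s≤s i≤n) =
  trans (suffix-suc {n} (λ t → f (toℕ t) ∸ f (suc (toℕ t))) i)
        (suffix-telescope {n} (f ∘ suc) (f-anti ∘ suc) fn≡0 i i≤n)

-- Subsequences and least ℓ-subset sums

minList-≤ : ∀ {z zs} → z ∈ zs → minList zs ≤ z
minList-≤ {z} {x ∷ xs} z∈ =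
  foldr-preservesᵒ (λ a b → [ m≤n⇒m⊓o≤n b , m≤n⇒o⊓m≤n a ]) x xs (bound z∈)
  where
  bound : z ∈ x ∷ xs → x ≤ z ⊎ Any.Any (_≤ z) xs
  bound (here refl) = inj₁ ≤-refl
  bound (there z∈)  = inj₂ (Any.map (≤-reflexive ∘ sym) z∈)

≤-minList : ∀ {g z zs} → z ∈ zs → (∀ {w} → w ∈ zs → g ≤ w) → g ≤ minList zs
≤-minList {zs = x ∷ xs} _ bound = foldr-preservesᵇ ⊓-glb (bound (here refl)) (All.tabulate (bound ∘ there))

module _ {A : Set} where

  ∈-choose⁺ : ∀ {S C xs : List A} → Interleaving S C xs → S ∈ choose (length S) xs
  ∈-choose⁺ []                    = here refl
  ∈-choose⁺ (consˡ sp)            = ∈-++⁺ˡ (∈-map⁺ _ (∈-choose⁺ sp))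
  ∈-choose⁺ {S = []}    (consʳ sp) = here refl
  ∈-choose⁺ {S = _ ∷ _} (consʳ sp) = ∈-++⁺ʳ _ (∈-choose⁺ sp)

  ∈-choose⁻ : ∀ ℓ (xs : List A) {S} → S ∈ choose ℓ xs → ∃ λ C → Interleaving S C xs × length S ≡ ℓ
  ∈-choose⁻ zero    xs       (here refl) = xs , right (Pointwise.refl refl) , refl
  ∈-choose⁻ (suc ℓ) (x ∷ xs) S∈ with ∈-++⁻ (map (x ∷_) (choose ℓ xs)) S∈
  ... | inj₁ S∈ₗ with ∈-map⁻ (x ∷_) S∈ₗ
  ...   | _ , S′∈ , refl with ∈-choose⁻ ℓ xs S′∈
  ...     | C , sp , refl = C , consˡ sp , refl
  ∈-choose⁻ (suc ℓ) (x ∷ xs) S∈ | inj₂ S∈ᵣ with ∈-choose⁻ (suc ℓ) xs S∈ᵣ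
  ... | C , sp , |S| = x ∷ C , consʳ sp , |S|

  greedy-interleaving : ∀ {P : A → Set} → (∀ a → Dec (P a)) → ∀ ℓ (xs : List A) → ℓ ≤ length xs →
                        ∃₂ λ S C → Interleaving S C xs × length S ≡ ℓ × (All P S ⊎ All (¬_ ∘ P) C)
  greedy-interleaving P? zero    xs       _         = [] , xs , right (Pointwise.refl refl) , refl , inj₁ []
  greedy-interleaving P? (suc ℓ) (x ∷ xs) (s≤s ℓ≤) with P? x | suc ℓ ≤? length xs
  ... | yes px | _ =
    let S , C , sp , |S| , all = greedy-interleaving P? ℓ xs ℓ≤
    in x ∷ S , C , consˡ sp , cong suc |S| , Sum.map₁ (px ∷_) all
  ... | no ¬px | yes ℓ< =
    let S , C , sp , |S| , all = greedy-interleaving P? (suc ℓ) xs ℓ<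
    in S , x ∷ C , consʳ sp , |S| , Sum.map₂ (¬px ∷_) all
  ... | no ¬px | no ℓ≮ =
    x ∷ xs , [] , left (Pointwise.refl refl) , cong suc (≤-antisym (≮⇒≥ ℓ≮) ℓ≤) , inj₂ []

  sum-interleaving : ∀ (f : A → ℕ) {S C xs} → Interleaving S C xs →
                     sum (map f xs) ≡ sum (map f S) + sum (map f C)
  sum-interleaving f {S} {C} {xs} sp = begin
    sum (map f xs)            ≡⟨ sum-↭ (↭.map⁺ f (toPermutation sp)) ⟩
    sum (map f (S ++ C))      ≡⟨ cong sum (map-++ f S C) ⟩
    sum (map f S ++ map f C)  ≡⟨ sum-++ (map f S) (map f C) ⟩
    sum (map f S) + sum (map f C) ∎
    where open ≡-Reasoning

  sum-map-≤ : ∀ (f : A → ℕ) {d S} → All (λ a → f a ≤ d) S → sum (map f S) ≤ length S * d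
  sum-map-≤ f []          = z≤n
  sum-map-≤ f (fa≤ ∷ f≤) = +-mono-≤ fa≤ (sum-map-≤ f f≤)

  sum-map-≥ : ∀ (f : A → ℕ) {d S} → All (λ a → d ≤ f a) S → length S * d ≤ sum (map f S)
  sum-map-≥ f []          = z≤n
  sum-map-≥ f (≤fa ∷ ≤f) = +-mono-≤ ≤fa (sum-map-≥ f ≤f)

∈⇒interleaving : ∀ {A : Set} {c : A} {xs} → c ∈ xs → ∃ λ S → Interleaving S (c ∷ []) xs
∈⇒interleaving {xs = _ ∷ xs} (here refl) = xs , consʳ (left (Pointwise.refl refl))
∈⇒interleaving (there c∈)               = let S , sp = ∈⇒interleaving c∈ in _ ∷ S , consˡ sp

minSubsetSum : ∀ {k} → ℕ → (Fin k → ℕ) → ℕ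
minSubsetSum {k} ℓ x = minList (map (λ S → sum (map x S)) (choose ℓ (allFin k)))

r≡minSubsetSum : ∀ {n k} (i j : Fin n) ℓ (μ : Tuple n k) →
                 r i j ℓ μ ≡ minSubsetSum ℓ (λ c → segment i j (μ c))
r≡minSubsetSum {k = k} i j ℓ μ = cong minList (map-cong segment-sumComps (choose ℓ (allFin k)))
  where
  b = λ t → (toℕ i ≤ᵇ toℕ t) ∧ (toℕ t ≤ᵇ toℕ j)
  segment-sumComps : ∀ S → segment i j (sumComps μ S) ≡ sum (map (λ c → segment i j (μ c)) S)
  segment-sumComps S = begin
    segment i j (sumComps μ S)                ≡⟨ segment≡maskedSum i j (sumComps μ S) ⟩
    maskedSum b (sumComps μ S)                ≡⟨ maskedSum-sum b μ S ⟩
    sum (map (λ c → maskedSum b (μ c)) S)     ≡⟨ cong sum (map-cong (λ c → segment≡maskedSum i j (μ c)) S) ⟨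
    sum (map (λ c → segment i j (μ c)) S)     ∎
    where open ≡-Reasoning

≤-length-allFin : ∀ {ℓ k} → ℓ ≤ k → ℓ ≤ length (allFin k)
≤-length-allFin ℓ≤k = subst (_ ≤_) (sym (length-tabulate id)) ℓ≤k

length-complement : ∀ {k S C} → Interleaving S C (allFin k) → length C ≡ k ∸ length S
length-complement {k} {S} {C} sp = begin
  length C                        ≡⟨ m+n∸m≡n (length S) (length C) ⟨
  length S + length C ∸ length S  ≡⟨ cong (_∸ length S) (interleave-length sp) ⟨
  length (allFin k) ∸ length S    ≡⟨ cong (_∸ length S) (length-tabulate id) ⟩
  k ∸ length S                    ∎
  where open ≡-Reasoning

module _ {k} (x : Fin k → ℕ) where

  sumF-interleaving : ∀ {S C} → Interleaving S C (allFin k) → sumF x ≡ sum (map x S) + sum (map x C)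
  sumF-interleaving sp = trans (sym (sum-map-allFin x)) (sum-interleaving x sp)

  minSubsetSum-≤ : ∀ {S C} → Interleaving S C (allFin k) → minSubsetSum (length S) x ≤ sum (map x S)
  minSubsetSum-≤ sp = minList-≤ (∈-map⁺ _ (∈-choose⁺ sp))

  ≤-minSubsetSum : ∀ {ℓ g} → ℓ ≤ k →
                   (∀ {S C} → Interleaving S C (allFin k) → length S ≡ ℓ → g ≤ sum (map x S)) →
                   g ≤ minSubsetSum ℓ x
  ≤-minSubsetSum {ℓ} {g} ℓ≤k bound
    with greedy-interleaving {P = λ _ → ⊤} (λ _ → yes tt) ℓ (allFin k) (≤-length-allFin ℓ≤k)
  ... | _ , _ , sp₀ , refl , _ = ≤-minList (∈-map⁺ _ (∈-choose⁺ sp₀)) bound′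
    where
    bound′ : ∀ {w} → w ∈ map (λ S → sum (map x S)) (choose ℓ (allFin k)) → g ≤ w
    bound′ w∈ with ∈-map⁻ _ w∈
    ... | S , S∈ , refl with ∈-choose⁻ ℓ (allFin k) S∈
    ... | C , sp , |S| = bound sp |S|

-- Balanced vectors

Balanced : ∀ {I : Set} → ℕ → (I → ℕ) → Set
Balanced d y = ∀ c → d ≤ y c × y c ≤ suc d

balanced⇒≡+χ : ∀ {I : Set} {d} {z : I → ℕ} → Balanced d z → ∀ c → z c ≡ d + χ (d <? z c)
balanced⇒≡+χ {d = d} {z} bal c with d <ᵇ z c | <ᵇ-reflects-< d (z c)
... | true  | ofʸ d<zc = trans (≤-antisym (proj₂ (bal c)) d<zc) (+-comm 1 d)
... | false | ofⁿ d≮zc = trans (≤-antisym (≮⇒≥ d≮zc) (proj₁ (bal c))) (sym (+-identityʳ d))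

-- The least ℓ-subset sum of a balanced vector with total D: an optimal subset consists of entries d only,
-- or leaves out only entries d + 1.
subsetBound : ℕ → ℕ → ℕ → ℕ → ℕ
subsetBound k D d ℓ = (ℓ * d) ⊔ (D ∸ (k ∸ ℓ) * suc d)

module _ {k : ℕ} where

  minSubsetSum-≤-subsetBound : ∀ (x : Fin k → ℕ) d {ℓ} → ℓ ≤ k →
                               minSubsetSum ℓ x ≤ subsetBound k (sumF x) d ℓ
  minSubsetSum-≤-subsetBound x d {ℓ} ℓ≤k
    with greedy-interleaving (λ c → x c ≤? d) ℓ (allFin k) (≤-length-allFin ℓ≤k)
  ... | S , C , sp , refl , inj₁ S≤d = ≤-trans (minSubsetSum-≤ x sp) (m≤n⇒m≤n⊔o _ (sum-map-≤ x S≤d))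
  ... | S , C , sp , refl , inj₂ C>d = ≤-trans (minSubsetSum-≤ x sp) (m≤n⇒m≤o⊔n _ (begin
    sum (map x S)                                  ≡⟨ m+n∸n≡m _ (sum (map x C)) ⟨
    sum (map x S) + sum (map x C) ∸ sum (map x C)  ≡⟨ cong (_∸ sum (map x C)) (sumF-interleaving x sp) ⟨
    sumF x ∸ sum (map x C)                         ≤⟨ ∸-monoʳ-≤ (sumF x) Σ[C]≥ ⟩
    sumF x ∸ (k ∸ length S) * suc d                ∎))
    where
    open ≤-Reasoning
    Σ[C]≥ : (k ∸ length S) * suc d ≤ sum (map x C)
    Σ[C]≥ = subst (λ m → m * suc d ≤ sum (map x C)) (length-complement sp) (sum-map-≥ x (All.map ≰⇒> C>d))

  subsetBound-≤-minSubsetSum : ∀ {y : Fin k → ℕ} {d ℓ} → Balanced d y → ℓ ≤ k →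
                               subsetBound k (sumF y) d ℓ ≤ minSubsetSum ℓ y
  subsetBound-≤-minSubsetSum {y} {d} y-bal ℓ≤k =
    ≤-minSubsetSum y ℓ≤k (λ sp |S| → subst (λ m → subsetBound k (sumF y) d m ≤ _) |S| (bound sp))
    where
    bound : ∀ {S C} → Interleaving S C (allFin k) → subsetBound k (sumF y) d (length S) ≤ sum (map y S)
    bound {S} {C} sp = ⊔-lub (sum-map-≥ y {S = S} (All.tabulate (λ {c} _ → proj₁ (y-bal c)))) (begin
      sumF y ∸ (k ∸ length S) * suc d                ≤⟨ ∸-monoʳ-≤ (sumF y) Σ[C]≤ ⟩
      sumF y ∸ sum (map y C)                         ≡⟨ cong (_∸ sum (map y C)) (sumF-interleaving y sp) ⟩
      sum (map y S) + sum (map y C) ∸ sum (map y C)  ≡⟨ m+n∸n≡m _ (sum (map y C)) ⟩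
      sum (map y S)                                  ∎)
      where
      open ≤-Reasoning
      Σ[C]≤ : sum (map y C) ≤ (k ∸ length S) * suc d
      Σ[C]≤ = subst (λ m → sum (map y C) ≤ m * suc d) (length-complement sp)
                    (sum-map-≤ y {S = C} (All.tabulate (λ {c} _ → proj₂ (y-bal c))))

  minSubsetSum-mono-balanced : ∀ {x y : Fin k → ℕ} {d ℓ} → Balanced d y → sumF x ≡ sumF y → ℓ ≤ k →
                               minSubsetSum ℓ x ≤ minSubsetSum ℓ y
  minSubsetSum-mono-balanced {x} {y} {d} {ℓ} y-bal Σx≡Σy ℓ≤k =
    ≤-trans (minSubsetSum-≤-subsetBound x d ℓ≤k)
            (subst (λ D → subsetBound k D d ℓ ≤ minSubsetSum ℓ y) (sym Σx≡Σy)
                   (subsetBound-≤-minSubsetSum y-bal ℓ≤k))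

  -- The 1-subsets bound each x c from below, the (k - 1)-subsets from above.
  balanced-if-minSubsetSum-≡ : ∀ {x y : Fin k → ℕ} {d} → Balanced d y → sumF x ≡ sumF y →
                               (∀ ℓ → 1 ≤ ℓ → ℓ ≤ k → minSubsetSum ℓ y ≡ minSubsetSum ℓ x) →
                               Balanced d x
  balanced-if-minSubsetSum-≡ {x} {y} {d} y-bal Σx≡Σy agree c with ∈⇒interleaving (∈-allFin c)
  ... | S , sp = d≤xc , xc≤1+d
    where
    open ≤-Reasoning
    1≤k : 1 ≤ k
    1≤k = ≤-trans (s≤s z≤n) (toℕ<n c)
    agree′ : ∀ ℓ → ℓ ≤ k → minSubsetSum ℓ y ≡ minSubsetSum ℓ x
    agree′ zero    _ = refl
    agree′ (suc ℓ)   = agree (suc ℓ) (s≤s z≤n)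
    |S|≤k : length S ≤ k
    |S|≤k = subst (length S ≤_) (length-tabulate id) (subst (length S ≤_) (sym (interleave-length sp)) (m≤m+n _ 1))
    [k∸|S|]*[1+d]≡1+d : (k ∸ length S) * suc d ≡ suc d
    [k∸|S|]*[1+d]≡1+d = trans (cong (_* suc d) (sym (length-complement sp))) (*-identityˡ (suc d))
    d≤xc : d ≤ x c
    d≤xc = begin
      d                 ≡⟨ *-identityˡ d ⟨
      1 * d             ≤⟨ m≤m⊔n (1 * d) _ ⟩
      subsetBound k (sumF y) d 1 ≤⟨ subsetBound-≤-minSubsetSum y-bal 1≤k ⟩
      minSubsetSum 1 y  ≡⟨ agree 1 ≤-refl 1≤k ⟩
      minSubsetSum 1 x  ≤⟨ minSubsetSum-≤ x (swap sp) ⟩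
      x c + 0           ≡⟨ +-identityʳ (x c) ⟩
      x c               ∎
    Σx∸1+d≤Σ[S] : sumF x ∸ suc d ≤ sum (map x S)
    Σx∸1+d≤Σ[S] = begin
      sumF x ∸ suc d                               ≡⟨ cong₂ _∸_ Σx≡Σy (sym [k∸|S|]*[1+d]≡1+d) ⟩
      sumF y ∸ (k ∸ length S) * suc d              ≤⟨ m≤n⊔m _ _ ⟩
      subsetBound k (sumF y) d (length S)          ≤⟨ subsetBound-≤-minSubsetSum y-bal |S|≤k ⟩
      minSubsetSum (length S) y                    ≡⟨ agree′ (length S) |S|≤k ⟩
      minSubsetSum (length S) x                    ≤⟨ minSubsetSum-≤ x sp ⟩
      sum (map x S)                                ∎
    xc≤1+d : x c ≤ suc d
    xc≤1+d = +-cancelˡ-≤ (sum (map x S)) (x c) (suc d) (begin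
      sum (map x S) + x c                ≡⟨ cong (sum (map x S) +_) (+-identityʳ (x c)) ⟨
      sum (map x S) + (x c + 0)          ≡⟨ sumF-interleaving x sp ⟨
      sumF x                             ≤⟨ m≤n+m∸n (sumF x) (suc d) ⟩
      suc d + (sumF x ∸ suc d)           ≤⟨ +-monoʳ-≤ (suc d) Σx∸1+d≤Σ[S] ⟩
      suc d + sum (map x S)              ≡⟨ +-comm (suc d) _ ⟩
      sum (map x S) + suc d              ∎)

-- Staircases and the suffix sums of λ^max

staircase : ℕ → ℕ → ℕ → ℕ
staircase q ρ c = q + χ (c <? ρ)

staircase-balanced : ∀ q ρ → Balanced q (staircase q ρ)
staircase-balanced q ρ c = m≤m+n q _ , subst (q + χ (c <? ρ) ≤_) (+-comm q 1) (+-monoʳ-≤ q (χ≤1 (c <? ρ)))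

sumF-χ-< : ∀ k ρ → ρ ≤ k → sumF {k} (λ c → χ (toℕ c <? ρ)) ≡ ρ
sumF-χ-< zero    zero    _         = refl
sumF-χ-< (suc k) zero    _         = trans (sumF-const k 0) (*-zeroʳ k)
sumF-χ-< (suc k) (suc ρ) (s≤s ρ≤k) = cong suc (sumF-χ-< k ρ ρ≤k)

staircase-mono : ∀ {q ρ q' ρ'} → q' ≤ q → (q' ≡ q → ρ' ≤ ρ) →
                 ∀ c → staircase q' ρ' c ≤ staircase q ρ c
staircase-mono {q} {ρ} {q'} {ρ'} q'≤q q'≡q⇒ρ'≤ρ c with m≤n⇒m<n∨m≡n q'≤q
... | inj₁ q'<q = begin
  q' + χ (c <? ρ') ≤⟨ +-monoʳ-≤ q' (χ≤1 (c <? ρ')) ⟩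
  q' + 1           ≡⟨ +-comm q' 1 ⟩
  suc q'           ≤⟨ q'<q ⟩
  q                ≤⟨ m≤m+n q _ ⟩
  q + χ (c <? ρ)   ∎
  where open ≤-Reasoning
... | inj₂ refl = +-monoʳ-≤ q (χ-mono (c <? ρ') (c <? ρ) (λ c<ρ' → <-≤-trans c<ρ' (q'≡q⇒ρ'≤ρ refl)))

m∸o≤[m+n]∸[o+p]≤1+m∸o : ∀ {m n o p} → o ≤ m → p ≤ n → n ≤ suc p →
                         m ∸ o ≤ (m + n) ∸ (o + p) × (m + n) ∸ (o + p) ≤ suc (m ∸ o)
m∸o≤[m+n]∸[o+p]≤1+m∸o {m} {n} {o} {p} o≤m p≤n n≤1+p =
  subst (λ z → m ∸ o ≤ z × z ≤ suc (m ∸ o)) (sym split)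
        (m≤m+n (m ∸ o) (n ∸ p) , subst (m ∸ o + (n ∸ p) ≤_) (+-comm (m ∸ o) 1) (+-monoʳ-≤ (m ∸ o) n∸p≤1))
  where
  n∸p≤1 : n ∸ p ≤ 1
  n∸p≤1 = m≤n+o⇒m∸n≤o n p (subst (n ≤_) (+-comm 1 p) n≤1+p)
  split : (m + n) ∸ (o + p) ≡ (m ∸ o) + (n ∸ p)
  split = begin
    (m + n) ∸ (o + p)  ≡⟨ ∸-+-assoc (m + n) o p ⟨
    (m + n) ∸ o ∸ p    ≡⟨ cong (_∸ p) (+-∸-comm n o≤m) ⟩
    (m ∸ o + n) ∸ p    ≡⟨ +-∸-assoc (m ∸ o) p≤n ⟩
    (m ∸ o) + (n ∸ p)  ∎
    where open ≡-Reasoning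

staircase-∸-balanced : ∀ {q ρ q' ρ'} → q' ≤ q → (q' ≡ q → ρ' ≤ ρ) →
                       ∃ λ d → Balanced d (λ c → staircase q ρ c ∸ staircase q' ρ' c)
staircase-∸-balanced {q} {ρ} {q'} {ρ'} q'≤q q'≡q⇒ρ'≤ρ with ρ' ≤? ρ | m≤n⇒m<n∨m≡n q'≤q
... | yes ρ'≤ρ | _ = q ∸ q' , λ c →
  m∸o≤[m+n]∸[o+p]≤1+m∸o q'≤q (χ-mono (c <? ρ') (c <? ρ) (λ c<ρ' → <-≤-trans c<ρ' ρ'≤ρ))
                             (≤-trans (χ≤1 (c <? ρ)) (s≤s z≤n))
... | no ρ'≰ρ | inj₂ q'≡q = contradiction (q'≡q⇒ρ'≤ρ q'≡q) ρ'≰ρ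
... | no ρ'≰ρ | inj₁ (s≤s {n = p} q'≤p) = p ∸ q' , λ c →
  -- compare p + (1 + [c < ρ]) with q' + [c < ρ'], where ρ < ρ'
  subst (λ z → p ∸ q' ≤ z ∸ staircase q' ρ' c × z ∸ staircase q' ρ' c ≤ suc (p ∸ q'))
        (+-suc p (χ (c <? ρ)))
        (m∸o≤[m+n]∸[o+p]≤1+m∸o q'≤p (≤-trans (χ≤1 (c <? ρ')) (s≤s z≤n))
                        (s≤s (χ-mono (c <? ρ) (c <? ρ') (λ c<ρ → <-≤-trans c<ρ (<⇒≤ (≰⇒> ρ'≰ρ))))))

module _ (k : ℕ) .{{_ : NonZero k}} where

  %-mono-if-/-≡ : ∀ {S' S} → S' ≤ S → S' / k ≡ S / k → S' % k ≤ S % k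
  %-mono-if-/-≡ {S'} {S} S'≤S quot≡ = +-cancelʳ-≤ (S / k * k) (S' % k) (S % k) (begin
    S' % k + S / k * k   ≡⟨ cong (λ q → S' % k + q * k) quot≡ ⟨
    S' % k + S' / k * k  ≡⟨ m≡m%n+[m/n]*n S' k ⟨
    S'                   ≤⟨ S'≤S ⟩
    S                    ≡⟨ m≡m%n+[m/n]*n S k ⟩
    S % k + S / k * k    ∎)
    where open ≤-Reasoning

  module _ {n} (lam : Weight n) where

    mCoef-antitone : ∀ i c → mCoef k lam (suc i) c ≤ mCoef k lam i c
    mCoef-antitone i c = staircase-mono (/-monoˡ-≤ k S'≤S) (%-mono-if-/-≡ S'≤S) (toℕ c)
      where S'≤S = suffix-antitone lam (n≤1+n i)

    mCoef-end : ∀ c → mCoef k lam n c ≡ 0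
    mCoef-end c = begin
      mCoef k lam n c
        ≡⟨ cong (λ S → staircase (S / k) (S % k) (toℕ c)) (suffix-end lam) ⟩
      staircase (0 / k) (0 % k) (toℕ c)
        ≡⟨ cong₂ (λ q ρ → staircase q ρ (toℕ c)) (0/n≡0 k) (n≤0⇒n≡0 (m%n≤m 0 k)) ⟩
      0 ∎
      where open ≡-Reasoning

    suffix-lmax : ∀ c i → i ≤ n → suffix (lmax k lam c) i ≡ mCoef k lam i c
    suffix-lmax c = suffix-telescope (λ i → mCoef k lam i c) (λ i → mCoef-antitone i c) (mCoef-end c)

    sumF-mCoef : ∀ i → sumF (mCoef k lam i) ≡ suffix lam i
    sumF-mCoef i = begin
      sumF (mCoef k lam i)                        ≡⟨ sumF-+ {k} (λ _ → S / k) steps ⟩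
      sumF {k} (λ _ → S / k) + sumF steps         ≡⟨ cong₂ _+_ (sumF-const k (S / k)) (sumF-χ-< k (S % k) ρ≤k) ⟩
      k * (S / k) + S % k                         ≡⟨ +-comm (k * (S / k)) (S % k) ⟩
      S % k + k * (S / k)                         ≡⟨ cong (S % k +_) (*-comm k (S / k)) ⟩
      S % k + S / k * k                           ≡⟨ m≡m%n+[m/n]*n S k ⟨
      S                                           ∎
      where
      open ≡-Reasoning
      S = suffix lam i
      steps = λ (c : Fin k) → χ (toℕ c <? S % k)
      ρ≤k = <⇒≤ (m%n<n S k)

    lmax-InP : InP lam (lmax k lam)
    lmax-InP t = begin
      sumF (λ c → mCoef k lam (toℕ t) c ∸ mCoef k lam (suc (toℕ t)) c)
        ≡⟨ sumF-∸ (mCoef k lam (toℕ t)) (mCoef k lam (suc (toℕ t))) (mCoef-antitone (toℕ t)) ⟩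
      sumF (mCoef k lam (toℕ t)) ∸ sumF (mCoef k lam (suc (toℕ t)))
        ≡⟨ cong₂ _∸_ (sumF-mCoef (toℕ t)) (sumF-mCoef (suc (toℕ t))) ⟩
      suffix lam (toℕ t) ∸ suffix lam (suc (toℕ t))
        ≡⟨ ≡suffix∸suffix lam t ⟨
      lam t
        ∎
      where open ≡-Reasoning

    segment-lmax : ∀ (i j : Fin n) → toℕ i ≤ toℕ j → ∀ c →
                   segment i j (lmax k lam c) ≡ mCoef k lam (toℕ i) c ∸ mCoef k lam (suc (toℕ j)) c
    segment-lmax i j i≤j c = trans (segment≡suffix∸suffix i j (lmax k lam c) i≤j)
      (cong₂ _∸_ (suffix-lmax c (toℕ i) (<⇒≤ (toℕ<n i))) (suffix-lmax c (suc (toℕ j)) (toℕ<n j)))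

    segment-lmax-balanced : ∀ (i j : Fin n) → toℕ i ≤ toℕ j →
                            ∃ λ d → Balanced d (λ c → segment i j (lmax k lam c))
    segment-lmax-balanced i j i≤j =
      let d , balanced = staircase-∸-balanced (/-monoˡ-≤ k S'≤S) (%-mono-if-/-≡ S'≤S)
      in d , λ c → subst (λ z → d ≤ z × z ≤ suc d) (sym (segment-lmax i j i≤j c)) (balanced (toℕ c))
      where S'≤S = suffix-antitone lam (≤-trans i≤j (n≤1+n (toℕ j)))

-- Nested families of subsets of Fin k

injective⇒surjective : ∀ {k} (f : Fin k → Fin k) → Injective _≡_ _≡_ f → ∀ y → ∃ λ x → f x ≡ y
injective⇒surjective {suc k} f f-inj y with any? (λ x → f x ≟ᶠ y)
... | yes hit = hit
... | no miss = contradiction (injective⇒≤ squeeze-injective) (<-irrefl refl)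
  where
  -- if y is not hit, punching it out of the image injects Fin (1 + k) into Fin k
  y≢f : ∀ x → y ≢ f x
  y≢f x y≡fx = miss (x , sym y≡fx)
  squeeze-injective : Injective _≡_ _≡_ (λ x → punchOut (y≢f x))
  squeeze-injective {a} {b} = f-inj ∘ punchOut-injective (y≢f a) (y≢f b)

injective⇒permutation : ∀ {k} (f : Fin k → Fin k) → Injective _≡_ _≡_ f →
                        ∃ λ (σ : Permutation k k) → ∀ c → σ ⟨$⟩ʳ c ≡ f c
injective⇒permutation f f-inj =
  permutation f (proj₁ ∘ surjective) (proj₂ ∘ surjective) (λ x → f-inj (proj₂ (surjective (f x)))) , λ _ → refl
  where surjective = injective⇒surjective f f-inj

-- If the sets {c | U c i} form a chain under inclusion, one permutation of Fin k turns all of them into initial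
-- segments: rank each c by the number of sets containing it.
module _ {k N} {U : Fin k → Fin N → Set} (U? : ∀ c i → Dec (U c i))
         (nested : ∀ {a b i i'} → U a i → ¬ U a i' → U b i' → ¬ U b i → ⊥) where

  private
    key : Fin k → ℕ
    key c = sumF (λ i → χ (U? c i))

    count : Fin N → ℕ
    count i = sumF (λ c → χ (U? c i))

    U-upward : ∀ {c z i} → key c ≤ key z → U c i → U z i
    U-upward {c} {z} {i} key≤ Uci = decidable-stable (U? z i) λ ¬Uzi →
      <⇒≱ (sumF-mono-< (row⊆ ¬Uzi) i (χ-mono-< (U? z i) (U? c i) ¬Uzi Uci)) key≤
      where
      row⊆ : ¬ U z i → ∀ i' → χ (U? z i') ≤ χ (U? c i')
      row⊆ ¬Uzi i' = χ-mono (U? z i') (U? c i') λ Uzi' →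
        decidable-stable (U? c i') (λ ¬Uci' → nested Uci ¬Uci' Uzi' ¬Uzi)

    _≺_ : Fin k → Fin k → Set
    a ≺ b = key b < key a ⊎ (key a ≡ key b × toℕ a < toℕ b)

    _≺?_ : ∀ a b → Dec (a ≺ b)
    a ≺? b = (key b <? key a) ⊎-dec ((key a ≟ key b) ×-dec (toℕ a <? toℕ b))

    ≺-irrefl : ∀ a → ¬ a ≺ a
    ≺-irrefl a (inj₁ lt)       = <-irrefl refl lt
    ≺-irrefl a (inj₂ (_ , lt)) = <-irrefl refl lt

    ≺⇒key≥ : ∀ {a b} → a ≺ b → key b ≤ key a
    ≺⇒key≥ (inj₁ lt)       = <⇒≤ lt
    ≺⇒key≥ (inj₂ (eq , _)) = ≤-reflexive (sym eq)

    ≺-trans : ∀ {a b c} → a ≺ b → b ≺ c → a ≺ c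
    ≺-trans (inj₁ lt)        (inj₁ lt')         = inj₁ (<-trans lt' lt)
    ≺-trans (inj₁ lt)        (inj₂ (eq' , _))   = inj₁ (subst (_< _) eq' lt)
    ≺-trans (inj₂ (eq , _))  (inj₁ lt')         = inj₁ (subst (_ <_) (sym eq) lt')
    ≺-trans (inj₂ (eq , lt)) (inj₂ (eq' , lt')) = inj₂ (trans eq eq' , <-trans lt lt')

    ≺-connex : ∀ a b → a ≢ b → a ≺ b ⊎ b ≺ a
    ≺-connex a b a≢b with <-cmp (key a) (key b) | <-cmp (toℕ a) (toℕ b)
    ... | tri< lt _ _ | _           = inj₂ (inj₁ lt)
    ... | tri> _ _ gt | _           = inj₁ (inj₁ gt)
    ... | tri≈ _ eq _ | tri< lt _ _ = inj₁ (inj₂ (eq , lt))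
    ... | tri≈ _ eq _ | tri> _ _ gt = inj₂ (inj₂ (sym eq , gt))
    ... | tri≈ _ _ _  | tri≈ _ eq _ = contradiction (toℕ-injective eq) a≢b

    rank : Fin k → ℕ
    rank c = sumF (λ z → χ (z ≺? c))

    rank<k : ∀ c → rank c < k
    rank<k c = subst (rank c <_) (trans (sumF-const k 1) (*-identityʳ k))
      (sumF-mono-< (λ z → χ≤1 (z ≺? c)) c (χ-mono-< (c ≺? c) (yes tt) (≺-irrefl c) tt))

    rank-mono-< : ∀ {a b} → a ≺ b → rank a < rank b
    rank-mono-< {a} {b} a≺b =
      sumF-mono-< (λ z → χ-mono (z ≺? a) (z ≺? b) (λ z≺a → ≺-trans z≺a a≺b)) a
                  (χ-mono-< (a ≺? a) (a ≺? b) (≺-irrefl a) a≺b)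

    rank-injective : ∀ {a b} → rank a ≡ rank b → a ≡ b
    rank-injective {a} {b} eq with a ≟ᶠ b
    ... | yes a≡b = a≡b
    ... | no a≢b  = [ (λ a≺b → contradiction eq (<⇒≢ (rank-mono-< a≺b)))
                    , (λ b≺a → contradiction (sym eq) (<⇒≢ (rank-mono-< b≺a))) ] (≺-connex a b a≢b)

    U⇔rank< : ∀ c i → U c i ⇔ rank c < count i
    U⇔rank< c i =
      mk⇔ rank<count (λ r<count → decidable-stable (U? c i) (λ ¬Uci → <⇒≱ r<count (count≤rank ¬Uci)))
      where
      rank<count : U c i → rank c < count i
      rank<count Uci = sumF-mono-< (λ z → χ-mono (z ≺? c) (U? z i) (λ z≺c → U-upward (≺⇒key≥ z≺c) Uci)) c
                                   (χ-mono-< (c ≺? c) (U? c i) (≺-irrefl c) Uci)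
      count≤rank : ¬ U c i → count i ≤ rank c
      count≤rank ¬Uci = sumF-mono-≤ λ z → χ-mono (U? z i) (z ≺? c) λ Uzi →
        decidable-stable (z ≺? c) (λ ¬z≺c → ¬Uci (U-upward (≮⇒≥ (¬z≺c ∘ inj₁)) Uzi))

  nested⇒initialSegments : ∃ λ (σ : Permutation k k) →
                           ∀ c i → U c i ⇔ toℕ (σ ⟨$⟩ʳ c) < sumF (λ z → χ (U? z i))
  nested⇒initialSegments with injective⇒permutation (λ c → fromℕ< (rank<k c)) fromℕ<-rank-injective
    where
    fromℕ<-rank-injective : Injective _≡_ _≡_ (λ c → fromℕ< (rank<k c))
    fromℕ<-rank-injective {a} {b} = rank-injective ∘ fromℕ<-injective (rank a) (rank b) (rank<k a) (rank<k b)
  ... | σ , σ≗ = σ , λ c i → subst (λ m → U c i ⇔ m < count i) (sym (toℕ-σ c)) (U⇔rank< c i)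
    where
    toℕ-σ : ∀ c → toℕ (σ ⟨$⟩ʳ c) ≡ rank c
    toℕ-σ c = trans (cong toℕ (σ≗ c)) (toℕ-fromℕ< (rank<k c))

-- Dominance and rigidity of λ^max

segment-sums-agree : ∀ {n k} {lam : Weight n} (μ ν : Tuple n k) → InP lam μ → InP lam ν →
                     ∀ i j → sumF (λ c → segment i j (μ c)) ≡ sumF (λ c → segment i j (ν c))
segment-sums-agree μ ν μ∈P ν∈P i j = trans (InP-segment μ μ∈P i j) (sym (InP-segment ν ν∈P i j))

lmax-dominates : ∀ {n} k .{{_ : NonZero k}} (lam : Weight n) (μ : Tuple n k) → InP lam μ → μ ⊴ lmax k lam
lmax-dominates k lam μ μ∈P i j i≤j ℓ _ ℓ≤k = begin
  r i j ℓ μ                                          ≡⟨ r≡minSubsetSum i j ℓ μ ⟩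
  minSubsetSum ℓ (λ c → segment i j (μ c))           ≤⟨ minSubsetSum-mono-balanced lmax-balanced sums-agree ℓ≤k ⟩
  minSubsetSum ℓ (λ c → segment i j (lmax k lam c))  ≡⟨ r≡minSubsetSum i j ℓ (lmax k lam) ⟨
  r i j ℓ (lmax k lam)                               ∎
  where
  open ≤-Reasoning
  lmax-balanced = proj₂ (segment-lmax-balanced k lam i j i≤j)
  sums-agree = segment-sums-agree μ (lmax k lam) μ∈P (lmax-InP k lam) i j

module _ {n k} .{{_ : NonZero k}} {lam : Weight (suc n)} (μ : Tuple (suc n) k) (μ∈P : InP lam μ)
         (lmax∼μ : lmax k lam ∼ μ) where

  private
    segment-balanced : ∀ {i j} → toℕ i ≤ toℕ j → ∀ {d} → Balanced d (λ c → segment i j (lmax k lam c)) →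
                       Balanced d (λ c → segment i j (μ c))
    segment-balanced {i} {j} i≤j bal =
      balanced-if-minSubsetSum-≡ bal (segment-sums-agree μ (lmax k lam) μ∈P (lmax-InP k lam) i j) λ ℓ 1≤ℓ ℓ≤k →
        trans (sym (r≡minSubsetSum i j ℓ (lmax k lam)))
              (trans (lmax∼μ i j i≤j ℓ 1≤ℓ ℓ≤k) (r≡minSubsetSum i j ℓ μ))

    last : Fin (suc n)
    last = fromℕ n

    ≤last : ∀ (i : Fin (suc n)) → toℕ i ≤ toℕ last
    ≤last i = subst (toℕ i ≤_) (sym (toℕ-fromℕ n)) (s≤s⁻¹ (toℕ<n i))

    segment-last : ∀ v i → segment i last v ≡ suffix v (toℕ i)
    segment-last v i = begin
      segment i last v
        ≡⟨ segment≡suffix∸suffix i last v (≤last i) ⟩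
      suffix v (toℕ i) ∸ suffix v (suc (toℕ last))
        ≡⟨ cong (λ m → suffix v (toℕ i) ∸ suffix v (suc m)) (toℕ-fromℕ n) ⟩
      suffix v (toℕ i) ∸ suffix v (suc n)
        ≡⟨ cong (suffix v (toℕ i) ∸_) (suffix-end v) ⟩
      suffix v (toℕ i) ∎
      where open ≡-Reasoning

    q : Fin (suc n) → ℕ
    q i = suffix lam (toℕ i) / k

    s : Fin k → Fin (suc n) → ℕ
    s c i = suffix (μ c) (toℕ i)

    suffix-balanced : ∀ i → Balanced (q i) (λ c → s c i)
    suffix-balanced i c =
      subst (λ z → q i ≤ z × z ≤ suc (q i)) (segment-last (μ c) i) (segment-balanced (≤last i) lmax-balanced c)
      where
      lmax-balanced : Balanced (q i) (λ c → segment i last (lmax k lam c))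
      lmax-balanced c = subst (λ z → q i ≤ z × z ≤ suc (q i))
        (sym (trans (segment-last (lmax k lam c) i) (suffix-lmax k lam c (toℕ i) (<⇒≤ (toℕ<n i)))))
        (staircase-balanced (q i) (suffix lam (toℕ i) % k) (toℕ c))

    Up : Fin k → Fin (suc n) → Set
    Up c i = q i < s c i

    -- Two components stepping up at different positions differ by 2 on the segment between them.
    Up-nested-< : ∀ {a b i i'} → toℕ i < toℕ i' → Up a i → ¬ Up a i' → Up b i' → ¬ Up b i → ⊥
    Up-nested-< {a} {b} {i} {fsuc j′} i<i' Uai ¬Uai' Ubi' ¬Ubi = <-irrefl refl (begin
      suc (q i)          ≤⟨ Uai ⟩
      s a i              ≡⟨ split a ⟨
      x a + s a i'       ≡⟨ cong (x a +_) (≤-antisym (≮⇒≥ ¬Uai') (proj₁ (suffix-balanced i' a))) ⟩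
      x a + q i'         ≤⟨ +-monoˡ-≤ (q i') (≤-trans (proj₂ (x-balanced a)) (s≤s (proj₁ (x-balanced b)))) ⟩
      suc (x b) + q i'   ≡⟨ +-suc (x b) (q i') ⟨
      x b + suc (q i')   ≡⟨ cong (x b +_) (≤-antisym (proj₂ (suffix-balanced i' b)) Ubi') ⟨
      x b + s b i'       ≡⟨ split b ⟩
      s b i              ≡⟨ ≤-antisym (≮⇒≥ ¬Ubi) (proj₁ (suffix-balanced i b)) ⟩
      q i                ∎)
      where
      open ≤-Reasoning
      i' = fsuc j′
      j = inject₁ j′
      i≤j : toℕ i ≤ toℕ j
      i≤j = subst (toℕ i ≤_) (sym (toℕ-inject₁ j′)) (s≤s⁻¹ i<i')
      x : Fin k → ℕ
      x c = segment i j (μ c)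
      x-balanced = segment-balanced i≤j (proj₂ (segment-lmax-balanced k lam i j i≤j))
      split : ∀ c → x c + s c i' ≡ s c i
      split c = trans (cong (λ m → x c + suffix (μ c) (suc m)) (sym (toℕ-inject₁ j′)))
                      (segment+suffix i j (μ c) i≤j)

    Up-nested : ∀ {a b i i'} → Up a i → ¬ Up a i' → Up b i' → ¬ Up b i → ⊥
    Up-nested {i = i} {i'} Uai ¬Uai' Ubi' ¬Ubi with <-cmp (toℕ i) (toℕ i')
    ... | tri< i<i' _ _ = Up-nested-< i<i' Uai ¬Uai' Ubi' ¬Ubi
    ... | tri> _ _ i'<i = Up-nested-< i'<i Ubi' ¬Ubi Uai ¬Uai'
    ... | tri≈ _ i≡i' _ = ¬Uai' (subst (Up _) (toℕ-injective i≡i') Uai)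

    Up? : ∀ c i → Dec (Up c i)
    Up? c i = q i <? s c i

    relabelling : ∃ λ (σ : Permutation k k) → ∀ c i → Up c i ⇔ toℕ (σ ⟨$⟩ʳ c) < sumF (λ z → χ (Up? z i))
    relabelling = nested⇒initialSegments Up? (λ {a} {b} {i} {i'} → Up-nested {a} {b} {i} {i'})

    σ : Permutation k k
    σ = proj₁ relabelling

    count≡ρ : ∀ i → sumF (λ c → χ (Up? c i)) ≡ suffix lam (toℕ i) % k
    count≡ρ i = +-cancelˡ-≡ (k * q i) count (suffix lam (toℕ i) % k) (begin
      k * q i + count                        ≡⟨ cong (_+ count) (sumF-const k (q i)) ⟨
      sumF {k} (λ _ → q i) + count           ≡⟨ sumF-+ {k} (λ _ → q i) (λ c → χ (Up? c i)) ⟨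
      sumF (λ c → q i + χ (Up? c i))         ≡⟨ sumF-cong (balanced⇒≡+χ (suffix-balanced i)) ⟨
      sumF (λ c → s c i)                     ≡⟨ InP-suffix μ μ∈P (toℕ i) ⟩
      suffix lam (toℕ i)                     ≡⟨ m≡m%n+[m/n]*n (suffix lam (toℕ i)) k ⟩
      suffix lam (toℕ i) % k + q i * k       ≡⟨ +-comm (suffix lam (toℕ i) % k) (q i * k) ⟩
      q i * k + suffix lam (toℕ i) % k       ≡⟨ cong (_+ suffix lam (toℕ i) % k) (*-comm (q i) k) ⟩
      k * q i + suffix lam (toℕ i) % k       ∎)
      where
      open ≡-Reasoning
      count = sumF (λ c → χ (Up? c i))

    suffix-μ : ∀ c i → i ≤ suc n → suffix (μ c) i ≡ mCoef k lam i (σ ⟨$⟩ʳ c)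
    suffix-μ c i i≤1+n with m≤n⇒m<n∨m≡n i≤1+n
    ... | inj₂ refl = trans (suffix-end (μ c)) (sym (mCoef-end k lam (σ ⟨$⟩ʳ c)))
    ... | inj₁ i<1+n = subst (λ m → suffix (μ c) m ≡ mCoef k lam m (σ ⟨$⟩ʳ c)) (toℕ-fromℕ< i<1+n) (begin
      s c i′                              ≡⟨ balanced⇒≡+χ (suffix-balanced i′) c ⟩
      q i′ + χ (Up? c i′)                 ≡⟨ cong (q i′ +_) (χ-cong (Up? c i′) (_ <? _) (proj₂ relabelling c i′)) ⟩
      q i′ + χ (toℕ (σ ⟨$⟩ʳ c) <? count)  ≡⟨ cong (λ m → q i′ + χ (toℕ (σ ⟨$⟩ʳ c) <? m)) (count≡ρ i′) ⟩
      mCoef k lam (toℕ i′) (σ ⟨$⟩ʳ c)     ∎)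
      where
      open ≡-Reasoning
      i′ = fromℕ< i<1+n
      count = sumF (λ z → χ (Up? z i′))

  lmax∼⇒permutation : ∃ λ (σ : Permutation k k) → ∀ m t → μ m t ≡ lmax k lam (σ ⟨$⟩ʳ m) t
  lmax∼⇒permutation = σ , λ m t → trans (≡suffix∸suffix (μ m) t)
    (cong₂ _∸_ (suffix-μ m (toℕ t) (<⇒≤ (toℕ<n t))) (suffix-μ m (suc (toℕ t)) (toℕ<n t)))

lemma3p3 : ∀ (n k : ℕ) .{{_ : NonZero k}} (lam : Weight n) →
    (∀ (μ : Tuple n k) → InP lam μ → μ ⊴ lmax k lam)
    × (∀ (μ : Tuple n k) → InP lam μ → lmax k lam ∼ μ →
        ∃ λ (σ : Permutation k k) → ∀ (m : Fin k) (t : Fin n) → μ m t ≡ lmax k lam (σ ⟨$⟩ʳ m) t)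
lemma3p3 n k lam = lmax-dominates k lam , lmax-determined n
  where
  lmax-determined : ∀ n {lam : Weight n} (μ : Tuple n k) → InP lam μ → lmax k lam ∼ μ →
                    ∃ λ (σ : Permutation k k) → ∀ m t → μ m t ≡ lmax k lam (σ ⟨$⟩ʳ m) t
  lmax-determined zero    μ _   _      = idₚ , λ _ ()
  lmax-determined (suc n) μ μ∈P lmax∼μ = lmax∼⇒permutation μ μ∈P lmax∼μ
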